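{- A finite simple graph $G$ is ds-reconstructible if and only if its complement $\bar{G}$ is ds-reconstructible.
   Context: For a vertex $v$ of a graph $G$, the card $G-v$ is the vertex-deleted subgraph. The card $G-v$ (and the vertex $v$) is called ds-completable if, for each integer $d$, the vertices having degree $d$ in $G-v$ are either all neighbours of $v$ in $G$ or all non-neighbours of $v$ in $G$. A graph is ds-reconstructible iff it has at least one ds-completable vertex. -}

module Defs where

open import Data.Nat using (ℕ)
open import Data.Fin using (Fin)
open import Data.Bool using (Bool; true; false; not; if_then_else_)
open import Data.List using (List; length; filter)
open import Data.List.Base using (allFin)
open import Data.Product using (Σ; ∃; _×_)
open import Data.Sum using (_⊎_)
open import Relation.Binary.PropositionalEquality using (_≡_)
open import Relation.Nullary using (¬_; Dec; yes; no)
open import Relation.Nullary.Decidable using (⌊_⌋)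
open import Data.Fin using (_≟_)

record Graph (n : ℕ) : Set where
  field
    adj       : Fin n → Fin n → Bool
    adj-sym   : ∀ u w → adj u w ≡ adj w u
    adj-irrefl : ∀ u → adj u u ≡ false
open Graph public

Adj : ∀ {n} → Graph n → Fin n → Fin n → Set
Adj G u w = adj G u w ≡ true

complement : ∀ {n} → Graph n → Graph n
complement {n} G = record
  { adj = cadj
  ; adj-sym = csym
  ; adj-irrefl = cirr
  }
  where
  cadj : Fin n → Fin n → Bool
  cadj u w with u ≟ w
  ... | yes _ = false
  ... | no  _ = not (adj G u w)
  csym : ∀ u w → cadj u w ≡ cadj w u
  csym u w with u ≟ w | w ≟ u
  ... | yes _ | yes _ = Relation.Binary.PropositionalEquality.refl
  ... | yes p | no q = Data.Empty.⊥-elim (q (Relation.Binary.PropositionalEquality.sym p))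
    where import Data.Empty
  ... | no p | yes q = Data.Empty.⊥-elim (p (Relation.Binary.PropositionalEquality.sym q))
    where import Data.Empty
  ... | no _ | no _ = Relation.Binary.PropositionalEquality.cong not (adj-sym G u w)
  cirr : ∀ u → cadj u u ≡ false
  cirr u with u ≟ u
  ... | yes _ = Relation.Binary.PropositionalEquality.refl
  ... | no p = Data.Empty.⊥-elim (p Relation.Binary.PropositionalEquality.refl)
    where import Data.Empty

-- Degree of u in the card G - v: the number of neighbours w of u in G with w ≠ v.
-- (Only meaningful for u ≠ v, which is how it is used below.)
degCard : ∀ {n} → Graph n → (v u : Fin n) → ℕ
degCard {n} G v u =
  length (filter (λ w → Relation.Nullary.Decidable.Core.T? (adj G u w Data.Bool.∧ not ⌊ w ≟ v ⌋)) (allFin n))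
  where import Relation.Nullary.Decidable.Core

DsCompletable : ∀ {n} → Graph n → Fin n → Set
DsCompletable G v =
  (d : ℕ) →
    (∀ u → ¬ (u ≡ v) → degCard G v u ≡ d → Adj G v u)
    ⊎ (∀ u → ¬ (u ≡ v) → degCard G v u ≡ d → ¬ Adj G v u)

DsReconstructible : ∀ {n} → Graph n → Set
DsReconstructible {n} G = ∃ λ (v : Fin n) → DsCompletable G v

module Submission where

-- Fix a vertex v and write Ḡ for the complement of G.  For every
-- other vertex u, each w ∈ V(G) is exactly one of: u itself, v itself, a
-- neighbour of u in G - v, or a neighbour of u in Ḡ - v.  Counting gives
--     deg_{G-v}(u) + deg_{Ḡ-v}(u) + 2 = n,
-- so on the cards G - v and Ḡ - v each degree determines the other, while v's
-- adjacency to every u ≠ v is flipped.  Hence a degree class of Ḡ - v is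
-- contained in a degree class of G - v, and if the latter lies entirely inside
-- (outside) N_G(v), the former lies entirely outside (inside) N_Ḡ(v).  So v is
-- ds-completable in Ḡ whenever it is in G, and conversely by the same argument.

open import Defs
open import Data.Nat using (ℕ; zero; suc; _+_; _∸_)
open import Data.Nat.Properties
  using (+-assoc; +-comm; m+n∸n≡m; +-commutativeSemigroup)
open import Algebra.Properties.CommutativeSemigroup +-commutativeSemigroup
  using (interchange)
open import Data.Bool using (Bool; true; false; not; _∧_)
open import Data.Bool.Properties using (not-involutive; not-¬; ¬-not)
open import Data.Fin using (Fin; _≟_)
import Data.Fin as Fin
open import Data.List using (List; []; _∷_; length; filter)
open import Data.List.Base using (allFin; tabulate)
open import Data.List.Properties using (length-tabulate)
open import Data.Product using (_×_; _,_)
open import Data.Sum using (inj₁; inj₂)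
open import Function using (_∘_; id)
open import Relation.Nullary using (yes; no)
open import Relation.Nullary.Decidable using (⌊_⌋)
open import Relation.Nullary.Decidable.Core using (T?)
open import Relation.Binary.PropositionalEquality
  using (_≡_; _≢_; refl; sym; trans; cong; cong₂; module ≡-Reasoning)
open import Data.Empty using (⊥-elim)

-- The number of elements of xs on which p holds; degCard unfolds to this.
count : ∀ {A : Set} → (A → Bool) → List A → ℕ
count p xs = length (filter (λ x → T? (p x)) xs)

[_] : Bool → ℕ
[ true ]  = 1
[ false ] = 0

count-∷ : ∀ {A : Set} (p : A → Bool) x xs → count p (x ∷ xs) ≡ [ p x ] + count p xs
count-∷ p x xs with p x
... | true  = refl
... | false = refl

count-split : ∀ {A : Set} (p q r : A → Bool) →
  (∀ x → [ p x ] + [ q x ] ≡ [ r x ]) →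
  ∀ xs → count p xs + count q xs ≡ count r xs
count-split p q r pointwise [] = refl
count-split p q r pointwise (x ∷ xs) = begin
  count p (x ∷ xs) + count q (x ∷ xs)
    ≡⟨ cong₂ _+_ (count-∷ p x xs) (count-∷ q x xs) ⟩
  ([ p x ] + count p xs) + ([ q x ] + count q xs)
    ≡⟨ interchange [ p x ] (count p xs) [ q x ] (count q xs) ⟩
  ([ p x ] + [ q x ]) + (count p xs + count q xs)
    ≡⟨ cong₂ _+_ (pointwise x) (count-split p q r pointwise xs) ⟩
  [ r x ] + count r xs
    ≡⟨ sym (count-∷ r x xs) ⟩
  count r (x ∷ xs) ∎
  where open ≡-Reasoning

count-true : ∀ {A : Set} (xs : List A) → count (λ _ → true) xs ≡ length xs
count-true []       = refl
count-true (x ∷ xs) = cong suc (count-true xs)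

count-tabulate : ∀ {A : Set} {n} (p : A → Bool) (f : Fin n → A) →
  count p (tabulate f) ≡ count (p ∘ f) (allFin n)
count-tabulate {n = zero}  p f = refl
count-tabulate {n = suc n} p f = begin
  count p (tabulate f)
    ≡⟨ count-∷ p (f Fin.zero) (tabulate (f ∘ Fin.suc)) ⟩
  [ p (f Fin.zero) ] + count p (tabulate (f ∘ Fin.suc))
    ≡⟨ cong ([ p (f Fin.zero) ] +_) (count-tabulate p (f ∘ Fin.suc)) ⟩
  [ p (f Fin.zero) ] + count (p ∘ f ∘ Fin.suc) (allFin n)
    ≡⟨ cong ([ p (f Fin.zero) ] +_) (sym (count-tabulate (p ∘ f) Fin.suc)) ⟩
  [ p (f Fin.zero) ] + count (p ∘ f) (tabulate Fin.suc)
    ≡⟨ sym (count-∷ (p ∘ f) Fin.zero (tabulate Fin.suc)) ⟩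
  count (p ∘ f) (allFin (suc n)) ∎
  where open ≡-Reasoning

count-false : ∀ {A : Set} (xs : List A) → count (λ _ → false) xs ≡ 0
count-false []       = refl
count-false (x ∷ xs) = count-false xs

count-cong : ∀ {A : Set} {p q : A → Bool} → (∀ x → p x ≡ q x) →
  ∀ xs → count p xs ≡ count q xs
count-cong p≗q [] = refl
count-cong {p = p} {q} p≗q (x ∷ xs) = begin
  count p (x ∷ xs)       ≡⟨ count-∷ p x xs ⟩
  [ p x ] + count p xs   ≡⟨ cong₂ _+_ (cong [_] (p≗q x)) (count-cong p≗q xs) ⟩
  [ q x ] + count q xs   ≡⟨ sym (count-∷ q x xs) ⟩
  count q (x ∷ xs)       ∎
  where open ≡-Reasoning

_==_ : ∀ {n} → Fin n → Fin n → Bool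
w == x = ⌊ w ≟ x ⌋

suc-== : ∀ {n} (w x : Fin n) → (Fin.suc w == Fin.suc x) ≡ (w == x)
suc-== w x with w ≟ x
... | yes _ = refl
... | no  _ = refl

count-single : ∀ {n} (x : Fin n) → count (_== x) (allFin n) ≡ 1
count-single {suc n} Fin.zero =
  cong suc (trans (count-tabulate (_== Fin.zero) (Fin.suc {n})) (count-false (allFin n)))
count-single {suc n} (Fin.suc x) = begin
  count (_== Fin.suc x) (tabulate Fin.suc)
    ≡⟨ count-tabulate (_== Fin.suc x) Fin.suc ⟩
  count (λ w → Fin.suc w == Fin.suc x) (allFin n)
    ≡⟨ count-cong (λ w → suc-== w x) (allFin n) ⟩
  count (_== x) (allFin n)
    ≡⟨ count-single x ⟩
  1 ∎
  where open ≡-Reasoning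

complement-adj : ∀ {n} (G : Graph n) {u w : Fin n} → u ≢ w →
  adj (complement G) u w ≡ not (adj G u w)
complement-adj G {u} {w} u≢w with u ≟ w
... | yes u≡w = ⊥-elim (u≢w u≡w)
... | no  _   = refl

neighbour-split : ∀ {n} (G : Graph n) (v u w : Fin n) →
  [ adj G u w ∧ not (w == v) ] + [ adj (complement G) u w ∧ not (w == v) ]
    ≡ [ not (w == u) ∧ not (w == v) ]
neighbour-split G v u w with w ≟ u
... | yes refl rewrite adj-irrefl G w | adj-irrefl (complement G) w = refl
... | no w≢u rewrite complement-adj G (w≢u ∘ sym) with adj G u w | w ≟ v
...   | true  | yes _ = refl
...   | true  | no  _ = refl
...   | false | yes _ = refl
...   | false | no  _ = refl

others-split : ∀ {n} {u v : Fin n} → u ≢ v → ∀ w →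
  [ not (w == u) ∧ not (w == v) ] + [ w == u ] ≡ [ not (w == v) ]
others-split {u = u} {v} u≢v w with w ≟ u
... | yes refl with w ≟ v
...   | yes w≡v = ⊥-elim (u≢v w≡v)
...   | no  _   = refl
others-split {u = u} {v} u≢v w | no _ with w ≟ v
...   | yes _ = refl
...   | no  _ = refl

excluded-middle : (b : Bool) → [ not b ] + [ b ] ≡ 1
excluded-middle true  = refl
excluded-middle false = refl

degree-sum : ∀ {n} (G : Graph n) (v u : Fin n) → u ≢ v →
  degCard G v u + degCard (complement G) v u + 2 ≡ n
degree-sum {n} G v u u≢v = begin
  degCard G v u + degCard (complement G) v u + 2
    ≡⟨ cong (_+ 2) (count-split _ _ others (neighbour-split G v u) vertices) ⟩
  count others vertices + 2
    ≡⟨ cong (count others vertices +_)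
            (sym (cong₂ _+_ (count-single u) (count-single v))) ⟩
  count others vertices + (count (_== u) vertices + count (_== v) vertices)
    ≡⟨ sym (+-assoc (count others vertices) _ _) ⟩
  count others vertices + count (_== u) vertices + count (_== v) vertices
    ≡⟨ cong (_+ count (_== v) vertices)
            (count-split _ _ _ (others-split u≢v) vertices) ⟩
  count (λ w → not (w == v)) vertices + count (_== v) vertices
    ≡⟨ count-split _ _ _ (λ w → excluded-middle (w == v)) vertices ⟩
  count (λ _ → true) vertices
    ≡⟨ count-true vertices ⟩
  length vertices
    ≡⟨ length-tabulate id ⟩
  n ∎
  where
  open ≡-Reasoning
  vertices : List (Fin n)
  vertices = allFin n
  others : Fin n → Bool
  others w = not (w == u) ∧ not (w == v)

summand-determined : ∀ {x y n} → x + y ≡ n → x ≡ n ∸ y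
summand-determined {x} {y} x+y≡n = trans (sym (m+n∸n≡m x y)) (cong (_∸ y) x+y≡n)

-- If v's adjacency in H is the negation of that in G, and each card degree in
-- H - v determines the card degree in G - v, then v ds-completable in G implies
-- v ds-completable in H: every degree class of H - v sits inside a degree class
-- of G - v, which lies wholly inside or wholly outside v's neighbourhood.
transfer : ∀ {n} (G H : Graph n) (v : Fin n) →
  (∀ u → u ≢ v → adj H v u ≡ not (adj G v u)) →
  (g : ℕ → ℕ) → (∀ u → u ≢ v → degCard G v u ≡ g (degCard H v u)) →
  DsCompletable G v → DsCompletable H v
transfer G H v flipped g determined completable d with completable (g d)
... | inj₁ allAdjacent = inj₂ λ u u≢v deg≡d adjH →
  let adjG = allAdjacent u u≢v (trans (determined u u≢v) (cong g deg≡d))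
  in  not-¬ adjH (trans (flipped u u≢v) (cong not adjG))
... | inj₂ noneAdjacent = inj₁ λ u u≢v deg≡d →
  let nonAdjG = noneAdjacent u u≢v (trans (determined u u≢v) (cong g deg≡d))
  in  trans (flipped u u≢v) (cong not (¬-not nonAdjG))

flip-sym : ∀ {a b : Bool} → a ≡ not b → b ≡ not a
flip-sym {a} {b} a≡¬b = sym (trans (cong not a≡¬b) (not-involutive b))

lemma3 : ∀ {n : ℕ} (G : Graph n) →
    (DsReconstructible G → DsReconstructible (complement G))
      × (DsReconstructible (complement G) → DsReconstructible G)
lemma3 {n} G =
    (λ { (v , completable) → v , transfer G Ḡ v
           (λ u u≢v → complement-adj G (u≢v ∘ sym))
           (λ d → n ∸ (d + 2)) degree-of-G completable })
  , (λ { (v , completable) → v , transfer Ḡ G v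
           (λ u u≢v → flip-sym (complement-adj G (u≢v ∘ sym)))
           (λ d → n ∸ (d + 2)) degree-of-Ḡ completable })
  where
  Ḡ : Graph n
  Ḡ = complement G
  degree-of-G : ∀ {v} u → u ≢ v → degCard G v u ≡ n ∸ (degCard Ḡ v u + 2)
  degree-of-G {v} u u≢v = summand-determined
    (trans (sym (+-assoc (degCard G v u) _ 2)) (degree-sum G v u u≢v))
  degree-of-Ḡ : ∀ {v} u → u ≢ v → degCard Ḡ v u ≡ n ∸ (degCard G v u + 2)
  degree-of-Ḡ {v} u u≢v = summand-determined
    (trans (trans (sym (+-assoc (degCard Ḡ v u) _ 2))
                  (cong (_+ 2) (+-comm (degCard Ḡ v u) (degCard G v u))))
           (degree-sum G v u u≢v))
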